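{- For any integer $C\ge 1$ and any $\epsilon>0$, there is an instance of \textsc{L-Sided Pricing} in which every $u\in L$ has capacity $C$ and every $v\in R$ has capacity $1$, whose locality gap with respect to the single-swap heuristic (i.e. the $1$-swap heuristic) is at least $2-\epsilon$.
   Context: An instance of \textsc{L-Sided Pricing} consists of a finite bipartite graph $G=(L\cup R,E)$ (each edge joins $L$ and $R$), a capacity $\mu_w\in\mathbb Z_{\ge 0}\cup\{\infty\}$ for every vertex $w$, and a budget $b_e\ge 0$ for every edge $e$. For $u\in L$ let $P_u=\{b_e: e\in E\text{ incident to }u\}$. A pricing is a function $p$ on $L$ with $p(u)\in P_u$ for every $u\in L$, extended by $p(v)=0$ for $v\in R$. For a pricing $p$, $\mathrm{val}(p)$ is the maximum of $\sum_{e=uv\in F}(p(u)+p(v))$ over all $F\subseteq E$ such that $p(u)+p(v)\le b_e$ for every $e=uv\in F$ and every vertex $w$ is incident to at most $\mu_w$ edges of $F$. Let $p^*$ be a pricing maximizing $\mathrm{val}$. For $\rho\ge1$, the locality gap of the instance with respect to the $\rho$-swap heuristic is the maximum of $\mathrm{val}(p^*)/\mathrm{val}(p)$ over all pricings $p$ such that $\mathrm{val}(p')\le\mathrm{val}(p)$ for every pricing $p'$ differing from $p$ on at most $\rho$ vertices of $L$.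
   Formalization: The parameter ε ranges over the positive rationals, and the budgets of the constructed instance are taken in the rationals. -}

module Defs where

open import Data.Nat as ℕ using (ℕ; zero; suc)
open import Data.Fin using (Fin; zero; suc)
open import Data.Bool using (Bool; true; false; if_then_else_)
open import Data.Maybe using (Maybe; just; nothing)
open import Data.Product using (Σ; ∃; ∃-syntax; _×_; _,_; proj₁; proj₂)
open import Data.Empty using (⊥)
open import Data.Unit using (⊤)
open import Relation.Nullary using (¬_; does)
open import Relation.Binary.PropositionalEquality using (_≡_; _≢_)
open import Data.Fin using (_≟_)
open import Data.Rational using (ℚ; 0ℚ; 1ℚ; _+_; _*_; _-_; _≤_; _<_)

-- Capacities: ℕ ∪ {∞}, with `nothing` standing for ∞.
ℕ∞ : Set
ℕ∞ = Maybe ℕ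

_≤∞_ : ℕ → ℕ∞ → Set
n ≤∞ just k  = n ℕ.≤ k
n ≤∞ nothing = ⊤

Σℚ : (m : ℕ) → (Fin m → ℚ) → ℚ
Σℚ zero    f = 0ℚ
Σℚ (suc m) f = f zero + Σℚ m (λ i → f (suc i))

Σℕ : (m : ℕ) → (Fin m → ℕ) → ℕ
Σℕ zero    f = 0
Σℕ (suc m) f = f zero ℕ.+ Σℕ m (λ i → f (suc i))

record Instance : Set where
  field
    nL nR m : ℕ
    left    : Fin m → Fin nL
    right   : Fin m → Fin nR
    simple  : ∀ e e′ → left e ≡ left e′ → right e ≡ right e′ → e ≡ e′
    capL    : Fin nL → ℕ∞
    capR    : Fin nR → ℕ∞
    budget  : Fin m → ℚ
    budget≥0 : ∀ e → 0ℚ ≤ budget e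

module _ (I : Instance) where
  open Instance I

  -- A pricing: p(u) ∈ P_u = { b_e : e incident to u } for every u ∈ L.
  -- (p(v) = 0 on R is implicit.)
  record Pricing : Set where
    field
      price   : Fin nL → ℚ
      inPrices : ∀ u → ∃[ e ] (left e ≡ u × price u ≡ budget e)

  open Pricing public

  EdgeSet : Set
  EdgeSet = Fin m → Bool

  degL : EdgeSet → Fin nL → ℕ
  degL F u = Σℕ m (λ e → if F e then (if does (left e ≟ u) then 1 else 0) else 0)

  degR : EdgeSet → Fin nR → ℕ
  degR F v = Σℕ m (λ e → if F e then (if does (right e ≟ v) then 1 else 0) else 0)

  -- p(u) + p(v) = p(u) since p(v) = 0 for v ∈ R.
  Feasible : Pricing → EdgeSet → Set
  Feasible p F =
    (∀ e → F e ≡ true → price p (left e) ≤ budget e) ×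
    (∀ u → degL F u ≤∞ capL u) ×
    (∀ v → degR F v ≤∞ capR v)

  value : Pricing → EdgeSet → ℚ
  value p F = Σℚ m (λ e → if F e then price p (left e) + 0ℚ else 0ℚ)

  IsVal : Pricing → ℚ → Set
  IsVal p x = (∃[ F ] (Feasible p F × value p F ≡ x))
            × (∀ F → Feasible p F → value p F ≤ x)

  DifferOnAtMostOne : Pricing → Pricing → Set
  DifferOnAtMostOne p p′ = ∃[ u ] (∀ w → w ≢ u → price p′ w ≡ price p w)

  IsOneSwapLocalOpt : Pricing → Set
  IsOneSwapLocalOpt p = ∃[ x ] (IsVal p x ×
    (∀ p′ x′ → DifferOnAtMostOne p p′ → IsVal p′ x′ → x′ ≤ x))

  IsOptimal : Pricing → Set
  IsOptimal p = ∃[ x ] (IsVal p x × (∀ p′ x′ → IsVal p′ x′ → x′ ≤ x))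

  -- The locality gap w.r.t. the 1-swap heuristic is at least γ:
  -- some 1-swap local optimum p and optimum p* with val(p*) > 0 and
  -- val(p*) ≥ γ · val(p)  (i.e. val(p*)/val(p) ≥ γ, with ratio +∞ if val(p)=0).
  OneSwapGapAtLeast : ℚ → Set
  OneSwapGapAtLeast γ =
    ∃[ p ] ∃[ pstar ] ∃[ x ] ∃[ xstar ]
      ( IsOneSwapLocalOpt p × IsOptimal pstar
      × IsVal p x × IsVal pstar xstar
      × 0ℚ < xstar × γ * x ≤ xstar )

-- The instance is K disjoint blocks, each a copy of K₂,₂ between the two left vertices a, b
-- (capacity K) and two fresh right vertices r₀, r₁ (capacity 1), with budgets
-- b(a,r₀) = n, b(a,r₁) = n + 1, b(b,r₀) = 1, b(b,r₁) = n + 2; so a pricing amounts to choosing,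
-- for each of a and b, the slot r₀ or r₁ whose budget it charges.  Charging (n + 1, 1) earns
-- n + 2 per block and is a single-swap local optimum: the better pricing (n, n + 2), earning
-- 2n + 2 per block, changes both prices, and with (n + 1, n + 2) both a and b can only sell to r₁.
-- Each such revenue bound is an instance of weak LP duality for b-matchings: capacity-weighted
-- vertex potentials that cover the price of every sold edge bound the revenue.  For n ≥ 2/ε the
-- ratio (2n + 2)/(n + 2) = 2 − 2/(n + 2) is at least 2 − ε.
module Submission where

open import Defs
open import Data.Nat using (ℕ; _≥_)
open import Data.Maybe using (just)
open import Data.Product using (∃-syntax; _×_)
open import Relation.Binary.PropositionalEquality using (_≡_)
open import Data.Rational using (ℚ; 0ℚ; 1ℚ; _+_; _-_; _<_)

open import Data.Bool using (Bool; true; false; if_then_else_)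
open import Data.Bool.Properties using (if-eta)
open import Data.Empty using (⊥-elim)
open import Data.Fin using (Fin; zero; suc; _≟_; _↑ˡ_; _↑ʳ_; combine; quotient; remainder; opposite)
open import Data.Fin.Properties using (0≢1+n; combine-injective; combine-remQuot; remQuot-combine)
open import Data.Integer as ℤ using (+[1+_]; -[1+_])
import Data.Integer.Properties as ℤₚ
open import Data.Nat as ℕ using (zero; suc; z≤n; s≤s)
import Data.Nat.Properties as ℕₚ
open import Algebra.Properties.CommutativeSemigroup ℕₚ.+-commutativeSemigroup using (interchange)
import Data.Nat.Solver as ℕ-Solver
open import Data.Product using (_,_; proj₁; proj₂)
open import Data.Rational using (_*_; _≤_; -_; mkℚ; toℚᵘ; nonNegative; *<*)
import Data.Rational.Properties as ℚ
import Data.Rational.Solver as ℚ-Solver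
open import Data.Rational.Unnormalised as ℚᵘ using (mkℚᵘ; *≡*; *≤*)
import Data.Rational.Unnormalised.Properties as ℚᵘₚ
open import Function using (id)
open import Relation.Binary.PropositionalEquality
  using (refl; sym; trans; cong; cong₂; subst; _≢_; module ≡-Reasoning)
open import Relation.Nullary using (¬_; does; yes; no)

-- Natural numbers inside ℚ

ι : ℕ → ℚ
ι zero    = 0ℚ
ι (suc n) = 1ℚ + ι n

ι-homo-+ : ∀ m n → ι (m ℕ.+ n) ≡ ι m + ι n
ι-homo-+ zero    n = sym (ℚ.+-identityˡ (ι n))
ι-homo-+ (suc m) n = trans (cong (1ℚ +_) (ι-homo-+ m n)) (sym (ℚ.+-assoc 1ℚ (ι m) (ι n)))

ι-homo-* : ∀ m n → ι (m ℕ.* n) ≡ ι m * ι n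
ι-homo-* zero    n = sym (ℚ.*-zeroˡ (ι n))
ι-homo-* (suc m) n = begin
  ι (n ℕ.+ m ℕ.* n)      ≡⟨ ι-homo-+ n (m ℕ.* n) ⟩
  ι n + ι (m ℕ.* n)      ≡⟨ cong₂ _+_ (ℚ.*-identityˡ (ι n)) (sym (ι-homo-* m n)) ⟨
  1ℚ * ι n + ι m * ι n   ≡⟨ ℚ.*-distribʳ-+ (ι n) 1ℚ (ι m) ⟨
  (1ℚ + ι m) * ι n       ∎
  where open ≡-Reasoning

ι<ι-suc : ∀ n → ι n < ι (suc n)
ι<ι-suc n = subst (_< 1ℚ + ι n) (ℚ.+-identityˡ (ι n)) (ℚ.+-monoˡ-< (ι n) 0<1)
  where
  0<1 : 0ℚ < 1ℚ
  0<1 = *<* (ℤ.+<+ (s≤s z≤n))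

ι-nonNeg : ∀ n → 0ℚ ≤ ι n
ι-nonNeg zero    = ℚ.≤-refl
ι-nonNeg (suc n) = ℚ.≤-trans (ι-nonNeg n) (ℚ.<⇒≤ (ι<ι-suc n))

ι-pos : ∀ {n} → 0 ℕ.< n → 0ℚ < ι n
ι-pos {suc n} _ = ℚ.≤-<-trans (ι-nonNeg n) (ι<ι-suc n)

ι-mono-≤ : ∀ {m n} → m ℕ.≤ n → ι m ≤ ι n
ι-mono-≤ {n = n} z≤n = ι-nonNeg n
ι-mono-≤ (s≤s m≤n)   = ℚ.+-monoʳ-≤ 1ℚ (ι-mono-≤ m≤n)

ι-cancel-≤ : ∀ {m n} → ι m ≤ ι n → m ℕ.≤ n
ι-cancel-≤ {m} {n} ιm≤ιn with m ℕ.≤? n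
... | yes m≤n = m≤n
... | no  m≰n = ⊥-elim (ℚ.<-irrefl refl
  (ℚ.<-≤-trans (ι<ι-suc n) (ℚ.≤-trans (ι-mono-≤ (ℕₚ.≰⇒> m≰n)) ιm≤ιn)))

ι-injective : ∀ {m n} → ι m ≡ ι n → m ≡ n
ι-injective ιm≡ιn =
  ℕₚ.≤-antisym (ι-cancel-≤ (ℚ.≤-reflexive ιm≡ιn)) (ι-cancel-≤ (ℚ.≤-reflexive (sym ιm≡ιn)))

toℚᵘ-ι : ∀ n → toℚᵘ (ι n) ℚᵘ.≃ mkℚᵘ (ℤ.+ n) 0
toℚᵘ-ι zero    = ℚᵘₚ.≃-refl
toℚᵘ-ι (suc n) = begin
  toℚᵘ (1ℚ + ι n)                ≈⟨ ℚ.toℚᵘ-homo-+ 1ℚ (ι n) ⟩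
  ℚᵘ.1ℚᵘ ℚᵘ.+ toℚᵘ (ι n)         ≈⟨ ℚᵘₚ.+-congʳ ℚᵘ.1ℚᵘ (toℚᵘ-ι n) ⟩
  ℚᵘ.1ℚᵘ ℚᵘ.+ mkℚᵘ (ℤ.+ n) 0      ≈⟨ *≡* (trans (ℤₚ.*-identityʳ _)
                                      (trans (cong (ℤ._+_ (ℤ.+ 1)) (ℤₚ.*-identityʳ (ℤ.+ n)))
                                             (sym (ℤₚ.*-identityʳ _)))) ⟩
  mkℚᵘ (ℤ.+ suc n) 0              ∎
  where open ℚᵘₚ.≃-Reasoning

-- A positive rational (k + 1) / (d + 1) times d + 1 is at least 1.
archimedean : ∀ {ε} → 0ℚ < ε → ∃[ d ] 1ℚ ≤ ε * ι d
archimedean {mkℚ (ℤ.+ 0)  _ _} (*<* (ℤ.+<+ ()))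
archimedean {mkℚ -[1+ _ ] _ _} (*<* ())
archimedean {ε@(mkℚ +[1+ k ] d _)} _ = suc d , ℚ.toℚᵘ-cancel-≤ (begin
  ℚᵘ.1ℚᵘ
    ≤⟨ *≤* (ℤ.+≤+ (s≤s d≤[d+k*[1+d]]*1)) ⟩
  mkℚᵘ +[1+ k ] d ℚᵘ.* mkℚᵘ (ℤ.+ suc d) 0
    ≃⟨ ℚᵘₚ.*-congˡ {mkℚᵘ +[1+ k ] d} (toℚᵘ-ι (suc d)) ⟨
  toℚᵘ ε ℚᵘ.* toℚᵘ (ι (suc d))
    ≃⟨ ℚ.toℚᵘ-homo-* ε (ι (suc d)) ⟨
  toℚᵘ (ε * ι (suc d))
    ∎)
  where
  open ℚᵘₚ.≤-Reasoning
  d≤[d+k*[1+d]]*1 : d ℕ.* 1 ℕ.+ 0 ℕ.≤ (d ℕ.+ k ℕ.* suc d) ℕ.* 1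
  d≤[d+k*[1+d]]*1 = ℕₚ.≤-trans (ℕₚ.≤-reflexive (ℕₚ.+-identityʳ (d ℕ.* 1)))
                               (ℕₚ.*-monoˡ-≤ 1 (ℕₚ.m≤m+n d _))

two≤ε*ι : ∀ {ε d N} → 0ℚ ≤ ε → 1ℚ ≤ ε * ι d → d ℕ.+ d ℕ.≤ N → ι 2 ≤ ε * ι N
two≤ε*ι {ε} {d} {N} 0≤ε 1≤εd d+d≤N = begin
  ι 2                     ≡⟨ cong (1ℚ +_) (ℚ.+-identityʳ 1ℚ) ⟩
  1ℚ + 1ℚ                 ≤⟨ ℚ.+-mono-≤ 1≤εd 1≤εd ⟩
  ε * ι d + ε * ι d       ≡⟨ ℚ.*-distribˡ-+ ε (ι d) (ι d) ⟨
  ε * (ι d + ι d)         ≡⟨ cong (ε *_) (ι-homo-+ d d) ⟨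
  ε * ι (d ℕ.+ d)         ≤⟨ ℚ.*-monoˡ-≤-nonNeg ε {{nonNegative 0≤ε}} (ι-mono-≤ d+d≤N) ⟩
  ε * ι N                 ∎
  where open ℚ.≤-Reasoning

two-minus-ε-≤ : ∀ ε x y z → x + x ≡ y + z → z ≤ ε * x → (1ℚ + 1ℚ - ε) * x ≤ y
two-minus-ε-≤ ε x y z x+x≡y+z z≤εx = begin
  (1ℚ + 1ℚ - ε) * x   ≡⟨ solve 2 (λ ε x → (con 1ℚ :+ con 1ℚ :- ε) :* x := x :+ x :- ε :* x)
                               refl ε x ⟩
  x + x - ε * x       ≡⟨ cong (_- ε * x) x+x≡y+z ⟩
  y + z - ε * x       ≤⟨ ℚ.+-monoʳ-≤ (y + z) (ℚ.neg-antimono-≤ z≤εx) ⟩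
  y + z - z           ≡⟨ solve 2 (λ y z → y :+ z :- z := y) refl y z ⟩
  y                   ∎
  where
  open ℚ.≤-Reasoning
  open ℚ-Solver.+-*-Solver

gap-bound : ∀ ε K N M → N ℕ.+ N ≡ M ℕ.+ 2 → ι 2 ≤ ε * ι N →
            (1ℚ + 1ℚ - ε) * ι (K ℕ.* N) ≤ ι (K ℕ.* M)
gap-bound ε K N M N+N≡M+2 2≤εN =
  two-minus-ε-≤ ε (ι (K ℕ.* N)) (ι (K ℕ.* M)) (ι (K ℕ.* 2)) doubled small
  where
  doubled : ι (K ℕ.* N) + ι (K ℕ.* N) ≡ ι (K ℕ.* M) + ι (K ℕ.* 2)
  doubled = begin
    ι (K ℕ.* N) + ι (K ℕ.* N)     ≡⟨ ι-homo-+ (K ℕ.* N) (K ℕ.* N) ⟨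
    ι (K ℕ.* N ℕ.+ K ℕ.* N)       ≡⟨ cong ι (ℕₚ.*-distribˡ-+ K N N) ⟨
    ι (K ℕ.* (N ℕ.+ N))           ≡⟨ cong (λ t → ι (K ℕ.* t)) N+N≡M+2 ⟩
    ι (K ℕ.* (M ℕ.+ 2))           ≡⟨ cong ι (ℕₚ.*-distribˡ-+ K M 2) ⟩
    ι (K ℕ.* M ℕ.+ K ℕ.* 2)       ≡⟨ ι-homo-+ (K ℕ.* M) (K ℕ.* 2) ⟩
    ι (K ℕ.* M) + ι (K ℕ.* 2)     ∎
    where open ≡-Reasoning
  small : ι (K ℕ.* 2) ≤ ε * ι (K ℕ.* N)
  small = begin
    ι (K ℕ.* 2)          ≡⟨ ι-homo-* K 2 ⟩
    ι K * ι 2            ≤⟨ ℚ.*-monoˡ-≤-nonNeg (ι K) {{nonNegative (ι-nonNeg K)}} 2≤εN ⟩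
    ι K * (ε * ι N)      ≡⟨ solve 3 (λ k ε n → k :* (ε :* n) := ε :* (k :* n))
                                  refl (ι K) ε (ι N) ⟩
    ε * (ι K * ι N)      ≡⟨ cong (ε *_) (ι-homo-* K N) ⟨
    ε * ι (K ℕ.* N)      ∎
    where
    open ℚ.≤-Reasoning
    open ℚ-Solver.+-*-Solver

-- Finite sums and weak duality

Σℕ-cong : ∀ m {f g : Fin m → ℕ} → (∀ i → f i ≡ g i) → Σℕ m f ≡ Σℕ m g
Σℕ-cong zero    f≗g = refl
Σℕ-cong (suc m) f≗g = cong₂ ℕ._+_ (f≗g zero) (Σℕ-cong m (λ i → f≗g (suc i)))

Σℕ-mono : ∀ m {f g : Fin m → ℕ} → (∀ i → f i ℕ.≤ g i) → Σℕ m f ℕ.≤ Σℕ m g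
Σℕ-mono zero    f≤g = z≤n
Σℕ-mono (suc m) f≤g = ℕₚ.+-mono-≤ (f≤g zero) (Σℕ-mono m (λ i → f≤g (suc i)))

Σℕ-zero : ∀ m → Σℕ m (λ _ → 0) ≡ 0
Σℕ-zero zero    = refl
Σℕ-zero (suc m) = Σℕ-zero m

Σℕ-+ : ∀ m (f g : Fin m → ℕ) → Σℕ m (λ i → f i ℕ.+ g i) ≡ Σℕ m f ℕ.+ Σℕ m g
Σℕ-+ zero    f g = refl
Σℕ-+ (suc m) f g =
  trans (cong (f zero ℕ.+ g zero ℕ.+_) (Σℕ-+ m (λ i → f (suc i)) (λ i → g (suc i))))
        (interchange (f zero) (g zero) (Σℕ m (λ i → f (suc i))) (Σℕ m (λ i → g (suc i))))

Σℕ-if-0 : ∀ m (F : Fin m → Bool) → Σℕ m (λ i → if F i then 0 else 0) ≡ 0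
Σℕ-if-0 m F = trans (Σℕ-cong m (λ i → if-eta (F i))) (Σℕ-zero m)

Σℕ-δ : ∀ {k} (f : Fin k → ℕ) y → Σℕ k (λ x → f x ℕ.* (if does (y ≟ x) then 1 else 0)) ≡ f y
Σℕ-δ {suc k} f zero    = begin
  f zero ℕ.* 1 ℕ.+ Σℕ k (λ x → f (suc x) ℕ.* 0)
    ≡⟨ cong₂ ℕ._+_ (ℕₚ.*-identityʳ (f zero))
                   (trans (Σℕ-cong k (λ x → ℕₚ.*-zeroʳ (f (suc x)))) (Σℕ-zero k)) ⟩
  f zero ℕ.+ 0
    ≡⟨ ℕₚ.+-identityʳ (f zero) ⟩
  f zero
    ∎
  where open ≡-Reasoning
Σℕ-δ {suc k} f (suc y) =
  trans (cong (ℕ._+ Σℕ k (λ x → f (suc x) ℕ.* (if does (y ≟ x) then 1 else 0))) (ℕₚ.*-zeroʳ (f zero)))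
        (Σℕ-δ (λ x → f (suc x)) y)

Σℕ-↑ : ∀ s t (g : Fin (s ℕ.+ t) → ℕ) →
       Σℕ (s ℕ.+ t) g ≡ Σℕ s (λ i → g (i ↑ˡ t)) ℕ.+ Σℕ t (λ j → g (s ↑ʳ j))
Σℕ-↑ zero    t g = refl
Σℕ-↑ (suc s) t g =
  trans (cong (g zero ℕ.+_) (Σℕ-↑ s t (λ i → g (suc i)))) (sym (ℕₚ.+-assoc (g zero) _ _))

remainder-↑ˡ : ∀ {K} s (i : Fin s) → remainder {suc K} s (i ↑ˡ (K ℕ.* s)) ≡ i
remainder-↑ˡ s i = cong proj₂ (remQuot-combine zero i)

remainder-↑ʳ : ∀ {K} s (j : Fin (K ℕ.* s)) → remainder {suc K} s (s ↑ʳ j) ≡ remainder {K} s j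
remainder-↑ʳ {K} s j = begin
  remainder {suc K} s (s ↑ʳ j)
    ≡⟨ cong (λ t → remainder {suc K} s (s ↑ʳ t)) (combine-remQuot {K} s j) ⟨
  remainder {suc K} s (combine (suc (quotient {K} s j)) (remainder {K} s j))
    ≡⟨ cong proj₂ (remQuot-combine (suc (quotient {K} s j)) (remainder {K} s j)) ⟩
  remainder {K} s j
    ∎
  where open ≡-Reasoning

Σℕ-remainder : ∀ K s (f : Fin s → ℕ) →
               Σℕ (K ℕ.* s) (λ v → f (remainder {K} s v)) ≡ K ℕ.* Σℕ s f
Σℕ-remainder zero    s f = refl
Σℕ-remainder (suc K) s f = trans (Σℕ-↑ s (K ℕ.* s) _)
  (cong₂ ℕ._+_ (Σℕ-cong s (λ i → cong f (remainder-↑ˡ s i)))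
               (trans (Σℕ-cong (K ℕ.* s) (λ j → cong f (remainder-↑ʳ s j))) (Σℕ-remainder K s f)))

Σℕ-pair : ∀ (f : Fin 2 → ℕ) K → Σℕ 2 (λ u → f u ℕ.* K) ≡ K ℕ.* (f zero ℕ.+ f (suc zero))
Σℕ-pair f K = begin
  f zero ℕ.* K ℕ.+ (f (suc zero) ℕ.* K ℕ.+ 0)  ≡⟨ cong (f zero ℕ.* K ℕ.+_) (ℕₚ.+-identityʳ _) ⟩
  f zero ℕ.* K ℕ.+ f (suc zero) ℕ.* K          ≡⟨ ℕₚ.*-distribʳ-+ K (f zero) (f (suc zero)) ⟨
  (f zero ℕ.+ f (suc zero)) ℕ.* K              ≡⟨ ℕₚ.*-comm _ K ⟩
  K ℕ.* (f zero ℕ.+ f (suc zero))              ∎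
  where open ≡-Reasoning

incidence : ∀ {m k} → (Fin m → Fin k) → (Fin m → Bool) → Fin k → ℕ
incidence {m} g F x = Σℕ m (λ e → if F e then (if does (g e ≟ x) then 1 else 0) else 0)

Σℕ-incidence : ∀ {m k} (g : Fin m → Fin k) (F : Fin m → Bool) (f : Fin k → ℕ) →
               Σℕ m (λ e → if F e then f (g e) else 0) ≡ Σℕ k (λ x → f x ℕ.* incidence g F x)
Σℕ-incidence {zero}  {k} g F f = sym (trans (Σℕ-cong k (λ x → ℕₚ.*-zeroʳ (f x))) (Σℕ-zero k))
Σℕ-incidence {suc m} {k} g F f with F zero
... | true  = sym (begin
  Σℕ k (λ x → f x ℕ.* (δ x ℕ.+ incidence g′ F′ x))
    ≡⟨ Σℕ-cong k (λ x → ℕₚ.*-distribˡ-+ (f x) (δ x) _) ⟩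
  Σℕ k (λ x → f x ℕ.* δ x ℕ.+ f x ℕ.* incidence g′ F′ x)
    ≡⟨ Σℕ-+ k _ _ ⟩
  Σℕ k (λ x → f x ℕ.* δ x) ℕ.+ Σℕ k (λ x → f x ℕ.* incidence g′ F′ x)
    ≡⟨ cong₂ ℕ._+_ (Σℕ-δ f (g zero)) (sym (Σℕ-incidence g′ F′ f)) ⟩
  f (g zero) ℕ.+ Σℕ m (λ e → if F′ e then f (g′ e) else 0)
    ∎)
  where
  open ≡-Reasoning
  g′ : Fin m → Fin k
  g′ e = g (suc e)
  F′ : Fin m → Bool
  F′ e = F (suc e)
  δ : Fin k → ℕ
  δ x = if does (g zero ≟ x) then 1 else 0
... | false = Σℕ-incidence (λ e → g (suc e)) (λ e → F (suc e)) f

weak-duality : ∀ {m a b} (l : Fin m → Fin a) (r : Fin m → Fin b) (F : Fin m → Bool)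
  (w : Fin m → ℕ) (y : Fin a → ℕ) (z : Fin b → ℕ) (cl : Fin a → ℕ) (cr : Fin b → ℕ) →
  (∀ e → F e ≡ true → w e ℕ.≤ y (l e) ℕ.+ z (r e)) →
  (∀ u → incidence l F u ℕ.≤ cl u) → (∀ v → incidence r F v ℕ.≤ cr v) →
  Σℕ m (λ e → if F e then w e else 0)
    ℕ.≤ Σℕ a (λ u → y u ℕ.* cl u) ℕ.+ Σℕ b (λ v → z v ℕ.* cr v)
weak-duality {m} {a} {b} l r F w y z cl cr covered l-cap r-cap = begin
  Σℕ m (λ e → if F e then w e else 0)
    ≤⟨ Σℕ-mono m pointwise ⟩
  Σℕ m (λ e → if F e then y (l e) ℕ.+ z (r e) else 0)
    ≡⟨ Σℕ-cong m (λ e → if-+ (F e)) ⟩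
  Σℕ m (λ e → (if F e then y (l e) else 0) ℕ.+ (if F e then z (r e) else 0))
    ≡⟨ Σℕ-+ m _ _ ⟩
  Σℕ m (λ e → if F e then y (l e) else 0) ℕ.+ Σℕ m (λ e → if F e then z (r e) else 0)
    ≡⟨ cong₂ ℕ._+_ (Σℕ-incidence l F y) (Σℕ-incidence r F z) ⟩
  Σℕ a (λ u → y u ℕ.* incidence l F u) ℕ.+ Σℕ b (λ v → z v ℕ.* incidence r F v)
    ≤⟨ ℕₚ.+-mono-≤ (Σℕ-mono a (λ u → ℕₚ.*-monoʳ-≤ (y u) (l-cap u)))
                   (Σℕ-mono b (λ v → ℕₚ.*-monoʳ-≤ (z v) (r-cap v))) ⟩
  Σℕ a (λ u → y u ℕ.* cl u) ℕ.+ Σℕ b (λ v → z v ℕ.* cr v)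
    ∎
  where
  open ℕₚ.≤-Reasoning
  pointwise : ∀ e → (if F e then w e else 0) ℕ.≤ (if F e then y (l e) ℕ.+ z (r e) else 0)
  pointwise e with F e in Fe
  ... | true  = covered e Fe
  ... | false = z≤n
  if-+ : ∀ c {p q} → (if c then p ℕ.+ q else 0) ≡ (if c then p else 0) ℕ.+ (if c then q else 0)
  if-+ true  = refl
  if-+ false = refl

-- Values of integral pricings

Σℚ-cong : ∀ m {f g : Fin m → ℚ} → (∀ i → f i ≡ g i) → Σℚ m f ≡ Σℚ m g
Σℚ-cong zero    f≗g = refl
Σℚ-cong (suc m) f≗g = cong₂ _+_ (f≗g zero) (Σℚ-cong m (λ i → f≗g (suc i)))

Σℚ-ι : ∀ m (f : Fin m → ℕ) → Σℚ m (λ i → ι (f i)) ≡ ι (Σℕ m f)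
Σℚ-ι zero    f = refl
Σℚ-ι (suc m) f = trans (cong (ι (f zero) +_) (Σℚ-ι m (λ i → f (suc i)))) (sym (ι-homo-+ (f zero) _))

value-ι : ∀ I (q : Pricing I) (π : Fin (Instance.nL I) → ℕ) → (∀ u → price q u ≡ ι (π u)) →
          ∀ F → value I q F ≡ ι (Σℕ (Instance.m I) (λ e → if F e then π (Instance.left I e) else 0))
value-ι I q π price≡ι F = trans (Σℚ-cong m term) (Σℚ-ι m _)
  where
  open Instance I
  term : ∀ e → (if F e then price q (left e) + 0ℚ else 0ℚ) ≡ ι (if F e then π (left e) else 0)
  term e with F e
  ... | true  = trans (ℚ.+-identityʳ _) (price≡ι (left e))
  ... | false = refl

IsVal⇒≤ : ∀ {I q x y} → IsVal I q x → (∀ F → Feasible I q F → value I q F ≤ y) → x ≤ y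
IsVal⇒≤ ((F , feasible , refl) , _) bounded = bounded F feasible

-- The instance

budgetOf : ℕ → Fin 2 → Fin 2 → ℕ
budgetOf n zero       zero       = n
budgetOf n zero       (suc zero) = suc n
budgetOf n (suc zero) zero       = 1
budgetOf n (suc zero) (suc zero) = suc (suc n)

budgetOf-injective : ∀ n u {s t} → budgetOf n u s ≡ budgetOf n u t → s ≡ t
budgetOf-injective n zero       {zero}     {zero}     _  = refl
budgetOf-injective n zero       {zero}     {suc zero} eq = ⊥-elim (ℕₚ.1+n≢n (sym eq))
budgetOf-injective n zero       {suc zero} {zero}     eq = ⊥-elim (ℕₚ.1+n≢n eq)
budgetOf-injective n zero       {suc zero} {suc zero} _  = refl
budgetOf-injective n (suc zero) {zero}     {zero}     _  = refl
budgetOf-injective n (suc zero) {zero}     {suc zero} ()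
budgetOf-injective n (suc zero) {suc zero} {zero}     ()
budgetOf-injective n (suc zero) {suc zero} {suc zero} _  = refl

priceSum : ℕ → (Fin 2 → Fin 2) → ℕ
priceSum n c = budgetOf n zero (c zero) ℕ.+ budgetOf n (suc zero) (c (suc zero))

-- Edge e is encoded as (block, left endpoint, slot of its right endpoint within the block).
blockOf : ∀ K → Fin (K ℕ.* 4) → Fin K
blockOf K = quotient {K} 4

sideOf : ∀ K → Fin (K ℕ.* 4) → Fin 2
sideOf K e = quotient {2} 2 (remainder {K} 4 e)

slotOf : ∀ K → Fin (K ℕ.* 4) → Fin 2
slotOf K e = remainder {2} 2 (remainder {K} 4 e)

rightEnd : ∀ K → Fin (K ℕ.* 4) → Fin (K ℕ.* 2)
rightEnd K e = combine (blockOf K e) (slotOf K e)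

edge : ∀ {K} → Fin K → Fin 2 → Fin 2 → Fin (K ℕ.* 4)
edge i u s = combine i (combine u s)

edge-parts : ∀ K (e : Fin (K ℕ.* 4)) → e ≡ edge (blockOf K e) (sideOf K e) (slotOf K e)
edge-parts K e = sym (trans (cong (combine (blockOf K e)) (combine-remQuot {2} 2 (remainder {K} 4 e)))
                            (combine-remQuot {K} 4 e))

sideOf-edge : ∀ K (i : Fin K) u s → sideOf K (edge i u s) ≡ u
sideOf-edge K i u s = trans (cong (quotient {2} 2) (cong proj₂ (remQuot-combine i (combine u s))))
                            (cong proj₁ (remQuot-combine u s))

slotOf-edge : ∀ K (i : Fin K) u s → slotOf K (edge i u s) ≡ s
slotOf-edge K i u s = trans (cong (remainder {2} 2) (cong proj₂ (remQuot-combine i (combine u s))))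
                            (cong proj₂ (remQuot-combine u s))

slotOf-rightEnd : ∀ K e → remainder {K} 2 (rightEnd K e) ≡ slotOf K e
slotOf-rightEnd K e = cong proj₂ (remQuot-combine (blockOf K e) (slotOf K e))

gadget-simple : ∀ K (e e′ : Fin (K ℕ.* 4)) →
                sideOf K e ≡ sideOf K e′ → rightEnd K e ≡ rightEnd K e′ → e ≡ e′
gadget-simple K e e′ same-side same-right
  with combine-injective (blockOf K e) (slotOf K e) (blockOf K e′) (slotOf K e′) same-right
... | same-block , same-slot = begin
  e                                                 ≡⟨ edge-parts K e ⟩
  edge (blockOf K e) (sideOf K e) (slotOf K e)      ≡⟨ cong₂ combine same-block
                                                               (cong₂ combine same-side same-slot) ⟩
  edge (blockOf K e′) (sideOf K e′) (slotOf K e′)   ≡⟨ edge-parts K e′ ⟨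
  e′                                                ∎
  where open ≡-Reasoning

gadget : ℕ → ℕ → Instance
gadget n K = record
  { nL       = 2
  ; nR       = K ℕ.* 2
  ; m        = K ℕ.* 4
  ; left     = sideOf K
  ; right    = rightEnd K
  ; simple   = gadget-simple K
  ; capL     = λ _ → just K
  ; capR     = λ _ → just 1
  ; budget   = λ e → ι (budgetOf n (sideOf K e) (slotOf K e))
  ; budget≥0 = λ e → ι-nonNeg (budgetOf n (sideOf K e) (slotOf K e))
  }

matching : ∀ K → (Fin 2 → Fin 2) → Fin (K ℕ.* 4) → Bool
matching K c e = does (c (sideOf K e) ≟ slotOf K e)

matching-degL : ∀ K c u → incidence (sideOf K) (matching K c) u ≡ K
matching-degL zero    c u = refl
matching-degL (suc K) c u with c zero | c (suc zero) | u
... | zero     | zero     | zero     = cong suc (matching-degL K c zero)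
... | zero     | zero     | suc zero = cong suc (matching-degL K c (suc zero))
... | zero     | suc zero | zero     = cong suc (matching-degL K c zero)
... | zero     | suc zero | suc zero = cong suc (matching-degL K c (suc zero))
... | suc zero | zero     | zero     = cong suc (matching-degL K c zero)
... | suc zero | zero     | suc zero = cong suc (matching-degL K c (suc zero))
... | suc zero | suc zero | zero     = cong suc (matching-degL K c zero)
... | suc zero | suc zero | suc zero = cong suc (matching-degL K c (suc zero))

matching-degR : ∀ K c → c zero ≢ c (suc zero) → ∀ v → incidence (rightEnd K) (matching K c) v ℕ.≤ 1
matching-degR zero    c _     ()
matching-degR (suc K) c c₀≢c₁ v with c zero | c (suc zero) | c₀≢c₁ | v
... | zero     | zero     | c₀≢c₁′ | _           = ⊥-elim (c₀≢c₁′ refl)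
... | suc zero | suc zero | c₀≢c₁′ | _           = ⊥-elim (c₀≢c₁′ refl)
... | zero     | suc zero | _      | zero        = s≤s (ℕₚ.≤-reflexive (Σℕ-if-0 _ (matching K c)))
... | zero     | suc zero | _      | suc zero    = s≤s (ℕₚ.≤-reflexive (Σℕ-if-0 _ (matching K c)))
... | zero     | suc zero | _      | suc (suc w) = matching-degR K c c₀≢c₁ w
... | suc zero | zero     | _      | zero        = s≤s (ℕₚ.≤-reflexive (Σℕ-if-0 _ (matching K c)))
... | suc zero | zero     | _      | suc zero    = s≤s (ℕₚ.≤-reflexive (Σℕ-if-0 _ (matching K c)))
... | suc zero | zero     | _      | suc (suc w) = matching-degR K c c₀≢c₁ w

blockRevenue : ℕ → Fin 2 → Fin 2 → ℕ
blockRevenue n (suc zero) (suc zero) = suc (suc n)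
blockRevenue n sa         sb         = budgetOf n zero sa ℕ.+ budgetOf n (suc zero) sb

blockRevenue-≤-local : ∀ n sa sb → ¬ (sa ≡ zero × sb ≡ suc zero) →
                       blockRevenue n sa sb ℕ.≤ blockRevenue n (suc zero) zero
blockRevenue-≤-local n zero       zero       _           = ℕₚ.n≤1+n (n ℕ.+ 1)
blockRevenue-≤-local n zero       (suc zero) not-optimal = ⊥-elim (not-optimal (refl , refl))
blockRevenue-≤-local n (suc zero) zero       _           = ℕₚ.≤-refl
blockRevenue-≤-local n (suc zero) (suc zero) _           = s≤s (ℕₚ.≤-reflexive (ℕₚ.+-comm 1 n))

blockRevenue-≤-optimal : ∀ n sa sb → blockRevenue n sa sb ℕ.≤ blockRevenue n zero (suc zero)
blockRevenue-≤-optimal n zero       zero       = ℕₚ.+-monoʳ-≤ n (s≤s z≤n)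
blockRevenue-≤-optimal n zero       (suc zero) = ℕₚ.≤-refl
blockRevenue-≤-optimal n (suc zero) zero       =
  ℕₚ.≤-trans (s≤s (ℕₚ.+-monoʳ-≤ n (s≤s z≤n))) (ℕₚ.≤-reflexive (sym (ℕₚ.+-suc n (suc n))))
blockRevenue-≤-optimal n (suc zero) (suc zero) = ℕₚ.m≤n+m (suc (suc n)) n

blockRevenue-doubling : ∀ n → blockRevenue n (suc zero) zero ℕ.+ blockRevenue n (suc zero) zero
                            ≡ blockRevenue n zero (suc zero) ℕ.+ 2
blockRevenue-doubling = solve 1 (λ n → (con 1 :+ n :+ con 1) :+ (con 1 :+ n :+ con 1)
                                     := (n :+ (con 2 :+ n)) :+ con 2) refl
  where open ℕ-Solver.+-*-Solver

-- Revenue of a slot choice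

module _ (n K : ℕ) where

  revenue : (Fin 2 → Fin 2) → (Fin (K ℕ.* 4) → Bool) → ℕ
  revenue c F = Σℕ (K ℕ.* 4) (λ e → if F e then budgetOf n (sideOf K e) (c (sideOf K e)) else 0)

  -- Feasibility of F for the pricing that charges each left vertex u the budget of slot c u.
  Admissible : (Fin 2 → Fin 2) → (Fin (K ℕ.* 4) → Bool) → Set
  Admissible c F =
    (∀ e → F e ≡ true →
           budgetOf n (sideOf K e) (c (sideOf K e)) ℕ.≤ budgetOf n (sideOf K e) (slotOf K e))
    × (∀ u → incidence (sideOf K) F u ℕ.≤ K) × (∀ v → incidence (rightEnd K) F v ℕ.≤ 1)

  revenue-≤-sides : ∀ c F → Admissible c F →
                    revenue c F ℕ.≤ K ℕ.* priceSum n c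
  revenue-≤-sides c F (_ , l-cap , r-cap) = ℕₚ.≤-trans
    (weak-duality (sideOf K) (rightEnd K) F (λ e → budgetOf n (sideOf K e) (c (sideOf K e)))
                  (λ u → budgetOf n u (c u)) (λ _ → 0) (λ _ → K) (λ _ → 1)
                  (λ e _ → ℕₚ.m≤m+n _ 0) l-cap r-cap)
    (ℕₚ.≤-reflexive (trans (cong₂ ℕ._+_ (Σℕ-pair (λ u → budgetOf n u (c u)) K)
                                        (Σℕ-zero (K ℕ.* 2)))
                           (ℕₚ.+-identityʳ _)))

  -- Once both prices are high, only the second right vertex of a block is affordable.
  revenue-≤-high : ∀ c F → c zero ≡ suc zero → c (suc zero) ≡ suc zero → Admissible c F →
                   revenue c F ℕ.≤ K ℕ.* suc (suc n)
  revenue-≤-high c F c₀ c₁ (affordable , l-cap , r-cap) = ℕₚ.≤-trans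
    (weak-duality (sideOf K) (rightEnd K) F (λ e → budgetOf n (sideOf K e) (c (sideOf K e)))
                  (λ _ → 0) (λ v → potential (remainder {K} 2 v)) (λ _ → K) (λ _ → 1)
                  covered l-cap r-cap)
    (ℕₚ.≤-reflexive (trans (Σℕ-cong (K ℕ.* 2) (λ v → ℕₚ.*-identityʳ _))
                           (trans (Σℕ-remainder K 2 potential) (cong (K ℕ.*_) (ℕₚ.+-identityʳ _)))))
    where
    potential : Fin 2 → ℕ
    potential zero       = 0
    potential (suc zero) = suc (suc n)
    high : ∀ u → c u ≡ suc zero
    high zero       = c₀
    high (suc zero) = c₁
    high-≤-potential : ∀ u s → budgetOf n u (suc zero) ℕ.≤ budgetOf n u s →
                       budgetOf n u (suc zero) ℕ.≤ potential s
    high-≤-potential zero       zero       n+1≤n       = ⊥-elim (ℕₚ.1+n≰n n+1≤n)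
    high-≤-potential zero       (suc zero) _           = ℕₚ.n≤1+n (suc n)
    high-≤-potential (suc zero) zero       (s≤s ())
    high-≤-potential (suc zero) (suc zero) _           = ℕₚ.≤-refl
    covered : ∀ e → F e ≡ true →
              budgetOf n (sideOf K e) (c (sideOf K e)) ℕ.≤ potential (remainder {K} 2 (rightEnd K e))
    covered e Fe = begin
      budgetOf n u (c u)             ≡⟨ cong (budgetOf n u) (high u) ⟩
      budgetOf n u (suc zero)        ≤⟨ high-≤-potential u (slotOf K e)
                                          (subst (λ s → budgetOf n u s ℕ.≤ budgetOf n u (slotOf K e))
                                                 (high u) (affordable e Fe)) ⟩
      potential (slotOf K e)         ≡⟨ cong potential (slotOf-rightEnd K e) ⟨
      potential (remainder {K} 2 (rightEnd K e)) ∎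
      where
      open ℕₚ.≤-Reasoning
      u : Fin 2
      u = sideOf K e

  revenue-≤ : ∀ c F → Admissible c F →
              revenue c F ℕ.≤ K ℕ.* blockRevenue n (c zero) (c (suc zero))
  revenue-≤ c F adm with c zero in c₀ | c (suc zero) in c₁ | revenue-≤-sides c F adm
  ... | zero     | zero     | bound = bound
  ... | zero     | suc zero | bound = bound
  ... | suc zero | zero     | bound = bound
  ... | suc zero | suc zero | _     = revenue-≤-high c F c₀ c₁ adm

  matching-revenue : ∀ c → revenue c (matching K c)
                         ≡ K ℕ.* priceSum n c
  matching-revenue c = begin
    revenue c (matching K c)
      ≡⟨ Σℕ-incidence (sideOf K) (matching K c) (λ u → budgetOf n u (c u)) ⟩
    Σℕ 2 (λ u → budgetOf n u (c u) ℕ.* incidence (sideOf K) (matching K c) u)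
      ≡⟨ Σℕ-cong 2 (λ u → cong (budgetOf n u (c u) ℕ.*_) (matching-degL K c u)) ⟩
    Σℕ 2 (λ u → budgetOf n u (c u) ℕ.* K)
      ≡⟨ Σℕ-pair (λ u → budgetOf n u (c u)) K ⟩
    K ℕ.* priceSum n c
      ∎
    where open ≡-Reasoning

  choiceOf : Pricing (gadget n K) → Fin 2 → Fin 2
  choiceOf q u = slotOf K (proj₁ (inPrices q u))

  price-choiceOf : ∀ q u → price q u ≡ ι (budgetOf n u (choiceOf q u))
  price-choiceOf q u with inPrices q u
  ... | e , refl , price≡budget = price≡budget

  feasible⇒admissible : ∀ q F → Feasible (gadget n K) q F → Admissible (choiceOf q) F
  feasible⇒admissible q F (affordable , l-cap , r-cap) = affordable′ , l-cap , r-cap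
    where
    affordable′ : ∀ e → F e ≡ true → budgetOf n (sideOf K e) (choiceOf q (sideOf K e))
                                     ℕ.≤ budgetOf n (sideOf K e) (slotOf K e)
    affordable′ e Fe = ι-cancel-≤
      (ℚ.≤-trans (ℚ.≤-reflexive (sym (price-choiceOf q (sideOf K e)))) (affordable e Fe))

  value-≤ : ∀ q F → Feasible (gadget n K) q F →
            value (gadget n K) q F ≤ ι (K ℕ.* blockRevenue n (choiceOf q zero) (choiceOf q (suc zero)))
  value-≤ q F feasible = ℚ.≤-trans
    (ℚ.≤-reflexive (value-ι (gadget n K) q (λ u → budgetOf n u (choiceOf q u)) (price-choiceOf q) F))
    (ι-mono-≤ (revenue-≤ (choiceOf q) F (feasible⇒admissible q F feasible)))

-- The two pricings

module _ (n k : ℕ) where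

  private
    K : ℕ
    K = suc k
    I : Instance
    I = gadget n K

  pricing : (Fin 2 → Fin 2) → Pricing I
  pricing c = record
    { price    = λ u → ι (budgetOf n u (c u))
    ; inPrices = λ u → edge {K} zero u (c u) , sideOf-edge K zero u (c u)
                     , cong₂ (λ v s → ι (budgetOf n v s)) (sym (sideOf-edge K zero u (c u)))
                                                          (sym (slotOf-edge K zero u (c u)))
    }

  choiceOf-agrees : ∀ q c u → price q u ≡ price (pricing c) u → choiceOf n K q u ≡ c u
  choiceOf-agrees q c u same =
    budgetOf-injective n u (ι-injective (trans (sym (price-choiceOf n K q u)) same))

  matching-feasible : ∀ c → c zero ≢ c (suc zero) → Feasible I (pricing c) (matching K c)
  matching-feasible c c₀≢c₁ =
    affordable , (λ u → ℕₚ.≤-reflexive (matching-degL K c u)) , matching-degR K c c₀≢c₁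
    where
    affordable : ∀ e → matching K c e ≡ true → price (pricing c) (sideOf K e) ≤ Instance.budget I e
    affordable e chosen with c (sideOf K e) ≟ slotOf K e | chosen
    ... | yes same | _  = ι-mono-≤ (ℕₚ.≤-reflexive (cong (budgetOf n (sideOf K e)) same))
    ... | no  _    | ()

  matching-value : ∀ c → value I (pricing c) (matching K c)
                       ≡ ι (K ℕ.* priceSum n c)
  matching-value c = trans (value-ι I (pricing c) (λ u → budgetOf n u (c u)) (λ _ → refl) (matching K c))
                           (cong ι (matching-revenue n K c))

  localPricing optimalPricing : Pricing I
  localPricing   = pricing opposite
  optimalPricing = pricing id

  localRevenue optimalRevenue : ℕ
  localRevenue   = K ℕ.* blockRevenue n (suc zero) zero
  optimalRevenue = K ℕ.* blockRevenue n zero (suc zero)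

  single-swap-misses-optimum : ∀ q → DifferOnAtMostOne I localPricing q →
                               ¬ (choiceOf n K q zero ≡ zero × choiceOf n K q (suc zero) ≡ suc zero)
  single-swap-misses-optimum q (zero , agree) (_ , q₁) =
    0≢1+n (trans (sym (choiceOf-agrees q opposite (suc zero) (agree (suc zero) λ ()))) q₁)
  single-swap-misses-optimum q (suc zero , agree) (q₀ , _) =
    0≢1+n (trans (sym q₀) (choiceOf-agrees q opposite zero (agree zero λ ())))

  single-swap-bound : ∀ q F → DifferOnAtMostOne I localPricing q → Feasible I q F →
                      value I q F ≤ ι localRevenue
  single-swap-bound q F near feasible = ℚ.≤-trans (value-≤ n K q F feasible)
    (ι-mono-≤ (ℕₚ.*-monoʳ-≤ K (blockRevenue-≤-local n (choiceOf n K q zero) (choiceOf n K q (suc zero))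
                                                     (single-swap-misses-optimum q near))))

  optimal-bound : ∀ q F → Feasible I q F → value I q F ≤ ι optimalRevenue
  optimal-bound q F feasible = ℚ.≤-trans (value-≤ n K q F feasible)
    (ι-mono-≤ (ℕₚ.*-monoʳ-≤ K (blockRevenue-≤-optimal n (choiceOf n K q zero)
                                                       (choiceOf n K q (suc zero)))))

  localValue : IsVal I localPricing (ι localRevenue)
  localValue = (matching K opposite , matching-feasible opposite (λ ()) , matching-value opposite)
             , λ F → single-swap-bound localPricing F (zero , λ _ _ → refl)

  optimalValue : IsVal I optimalPricing (ι optimalRevenue)
  optimalValue = (matching K id , matching-feasible id (λ ()) , matching-value id)
               , optimal-bound optimalPricing

  localOptimum : IsOneSwapLocalOpt I localPricing
  localOptimum = ι localRevenue , localValue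
               , λ q _ near val → IsVal⇒≤ {I} {q} val (λ F → single-swap-bound q F near)

  optimum : IsOptimal I optimalPricing
  optimum = ι optimalRevenue , optimalValue , λ q _ val → IsVal⇒≤ {I} {q} val (optimal-bound q)

  optimalRevenue-pos : 0ℚ < ι optimalRevenue
  optimalRevenue-pos = ℚ.<-≤-trans (ι-pos {localRevenue} (s≤s z≤n))
                                   (proj₂ (proj₂ optimum) localPricing (ι localRevenue) localValue)

theorem11 : (C : ℕ) → C ≥ 1 → (ε : ℚ) → 0ℚ < ε →
    ∃[ I ] ((∀ u → Instance.capL I u ≡ just C)
          × (∀ v → Instance.capR I v ≡ just 1)
          × OneSwapGapAtLeast I ((1ℚ + 1ℚ) - ε))
theorem11 (suc k) (s≤s z≤n) ε 0<ε with archimedean 0<ε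
... | d , 1≤εd =
  gadget n (suc k) , (λ _ → refl) , (λ _ → refl)
  , localPricing n k , optimalPricing n k , ι (localRevenue n k) , ι (optimalRevenue n k)
  , localOptimum n k , optimum n k , localValue n k , optimalValue n k
  , optimalRevenue-pos n k
  , gap-bound ε (suc k) N M (blockRevenue-doubling n)
              (two≤ε*ι {ε} {d} {N} (ℚ.<⇒≤ 0<ε) 1≤εd d+d≤N)
  where
  n N M : ℕ
  n = d ℕ.+ d
  N = blockRevenue n (suc zero) zero
  M = blockRevenue n zero (suc zero)
  d+d≤N : d ℕ.+ d ℕ.≤ N
  d+d≤N = ℕₚ.≤-trans (ℕₚ.m≤m+n n 1) (ℕₚ.n≤1+n (n ℕ.+ 1))
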